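{- Let $n\geq1$ and $\mathcal{K}^{(n)}(x,t)=\sum_{\ell(\lambda)\leq n}\sum_{w\in S_n}K_{\lambda,w}(x)t^\lambda\varepsilon_{ww_0}$. Then for every $1\leq i<n$ we have $\pi_i\big(\mathcal{K}^{(n)}(x,t)\big)=(\varepsilon_i+1)\mathcal{K}^{(n)}(x,t)$, where $\pi_i$ acts on the $x$-variables and $\varepsilon_i$ multiplies (on the left) in the algebra part.
   Context: $S_n$ is the symmetric group on $\{1,\dots,n\}$, permutations compose as functions, $s_i$ is the transposition of $i,i+1$, $\ell(w)$ is the length, and $w_0\in S_n$ is the longest element ($w_0(j)=n+1-j$). On polynomials in $x_1,x_2,\dots$, $s_i$ interchanges $x_i,x_{i+1}$, $\partial_if=(f-s_if)/(x_i-x_{i+1})$ and $\pi_if=\partial_i(x_if)$; for a reduced expression $w=s_{i_1}\cdots s_{i_m}$, $\pi_w=\pi_{i_1}\circ\cdots\circ\pi_{i_m}$. For a partition $\lambda$ (non-increasing, eventually zero, non-negative integer sequence; $\ell(\lambda)$ = number of non-zero parts), $x^\lambda=\prod x_i^{\lambda_i}$, $t^\lambda=\prod t_i^{\lambda_i}$, and $K_{\lambda,w}=\pi_w(x^\lambda)$. The twisted Demazure algebra is the free module with basis $\{\varepsilon_v\}_{v\in S_n}$ (over the ring of formal power series in $x,t$, whose elements commute with the $\varepsilon$'s), with $\varepsilon_i:=\varepsilon_{s_i}$ and multiplication determined by $\varepsilon_i\varepsilon_v=\varepsilon_{s_iv}$ if $\ell(s_iv)>\ell(v)$ and $\varepsilon_i\varepsilon_v=-\varepsilon_v$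 if $\ell(s_iv)<\ell(v)$ (so $\varepsilon_i^2=-\varepsilon_i$ and the $\varepsilon_i$ satisfy the braid relations). -}

module Defs where

open import Data.Bool using (Bool; true; false; if_then_else_; _∧_)
open import Data.Nat as ℕ using (ℕ; zero; suc; pred)
open import Data.Integer as ℤ using (ℤ; 0ℤ; 1ℤ; -1ℤ)
open import Data.Fin as Fin using (Fin; inject₁; toℕ)
open import Data.Fin.Properties using (all?)
open import Data.Fin.Permutation using (Permutation′; _⟨$⟩ʳ_; _∘ₚ_; transpose; reverse; _≈_)
import Data.Fin.Permutation.Components as PC
open import Data.Vec as Vec using (Vec; []; _∷_; lookup; tabulate; updateAt)
open import Data.Vec.Properties using (≡-dec)
open import Data.List as List using (List; []; _∷_; upTo; foldr; length)
open import Data.Nat.ListAction using () renaming (sum to sumℕ)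
open import Data.Product using (_×_)
open import Relation.Nullary using (does)
open import Relation.Binary.PropositionalEquality using (_≡_)

-- Conventions.  n = suc m  (so n ≥ 1).  Variables x_1..x_n are indexed
-- by Fin n (0-based), and the index i with 1 ≤ i < n is an element
-- i : Fin m, with  x_i ↦ inject₁ i  and  x_{i+1} ↦ suc i.

-- Exponent vectors and formal power series in x_1..x_n with ℤ coefficients
-- (a series is its coefficient function).
Exp : ℕ → Set
Exp n = Vec ℕ n

Series : ℕ → Set
Series n = Exp n → ℤ

zeroS : ∀ {n} → Series n
zeroS _ = 0ℤ

_+S_ : ∀ {n} → Series n → Series n → Series n
(f +S g) α = f α ℤ.+ g α

_-S_ : ∀ {n} → Series n → Series n → Series n
(f -S g) α = f α ℤ.- g α

_·S_ : ∀ {n} → ℤ → Series n → Series n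
(c ·S f) α = c ℤ.* f α

monomial : ∀ {n} → Exp n → Series n
monomial λ' α = if does (≡-dec ℕ._≟_ α λ') then 1ℤ else 0ℤ

mulX : ∀ {n} → Fin n → Series n → Series n
mulX j f α with lookup α j
... | zero  = 0ℤ
... | suc _ = f (updateAt α j pred)

sS : ∀ {m} → Fin m → Series (suc m) → Series (suc m)
sS i f α = f (tabulate λ l → lookup α (PC.transpose (inject₁ i) (Fin.suc i) l))

sumℤ : List ℤ → ℤ
sumℤ = foldr ℤ._+_ 0ℤ

-- Exact division by (x_i - x_{i+1}):  if h = (x_i - x_{i+1}) g then
-- g(β) = Σ_{k=0}^{β_{i+1}} h(β + (k+1) e_i - k e_{i+1}).
divDiff : ∀ {m} → Fin m → Series (suc m) → Series (suc m)
divDiff i h β = sumℤ (List.map term (upTo (suc (lookup β (Fin.suc i)))))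
  where
  term : ℕ → ℤ
  term k = h (updateAt (updateAt β (inject₁ i) (λ a → a ℕ.+ suc k))
                       (Fin.suc i) (λ b → b ℕ.∸ k))

∂ : ∀ {m} → Fin m → Series (suc m) → Series (suc m)
∂ i f = divDiff i (f -S sS i f)

πD : ∀ {m} → Fin m → Series (suc m) → Series (suc m)
πD i f = ∂ i (mulX (inject₁ i) f)

πWord : ∀ {m} → List (Fin m) → Series (suc m) → Series (suc m)
πWord []       f = f
πWord (i ∷ ws) f = πD i (πWord ws f)

Perm : ℕ → Set
Perm = Permutation′

-- (v · w)(j) = v (w j)
_·_ : ∀ {n} → Perm n → Perm n → Perm n
v · w = w ∘ₚ v

idP : ∀ {n} → Perm n
idP = Data.Fin.Permutation.id

s : ∀ {m} → Fin m → Perm (suc m)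
s i = transpose (inject₁ i) (Fin.suc i)

w₀ : ∀ {n} → Perm n
w₀ = reverse

ℓ : ∀ {n} → Perm n → ℕ
ℓ {n} w = sumℕ (List.map inv (List.allFin n))
  where
  inv : Fin n → ℕ
  inv a = sumℕ (List.map (λ b → if does (toℕ a ℕ.<? toℕ b) ∧ does (toℕ (w ⟨$⟩ʳ b) ℕ.<? toℕ (w ⟨$⟩ʳ a)) then 1 else 0) (List.allFin n))

_≈?_ : ∀ {n} → Perm n → Perm n → Bool
v ≈? w = does (all? λ j → v ⟨$⟩ʳ j Fin.≟ w ⟨$⟩ʳ j)

sWord : ∀ {m} → List (Fin m) → Perm (suc m)
sWord []       = idP
sWord (i ∷ ws) = s i · sWord ws

Reduced : ∀ {m} → List (Fin m) → Perm (suc m) → Set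
Reduced ws w = (length ws ≡ ℓ w) × (sWord ws ≈ w)

-- Twisted Demazure algebra: an element Σ_v a_v ε_v is its coefficient
-- function v ↦ a_v.

Alg : ℕ → Set
Alg m = Perm (suc m) → Series (suc m)

εεcoef : ∀ {m} → Fin m → Perm (suc m) → Perm (suc m) → ℤ
εεcoef i u v =
  if does (ℓ u ℕ.<? ℓ (s i · u))
  then (if (s i · u) ≈? v then 1ℤ else 0ℤ)
  else (if u ≈? v then -1ℤ else 0ℤ)

-- The only u for which ε_i ε_u has a nonzero ε_v-coefficient are
-- u = v and u = s_i v (these are distinct), so the coefficient of ε_v is:
εmul : ∀ {m} → Fin m → Alg m → Alg m
εmul i A v = (εεcoef i v v ·S A v) +S (εεcoef i (s i · v) v ·S A (s i · v))

-- Partitions of length ≤ n as non-increasing vectors in ℕ^n; elements of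
-- the algebra over power series in x and t are given by their
-- t-coefficients: t-exponent β ↦ element of Alg m.

isPartition : ∀ {n} → Vec ℕ n → Bool
isPartition []           = true
isPartition (a ∷ [])     = true
isPartition (a ∷ b ∷ xs) = does (b ℕ.≤? a) ∧ isPartition (b ∷ xs)

TAlg : ℕ → Set
TAlg m = Exp (suc m) → Alg m

-- 𝒦^{(n)} = Σ_{ℓ(λ)≤n} Σ_w K_{λ,w} t^λ ε_{w w₀}; the coefficient of t^β ε_v
-- is K_{β, v w₀} if β is a partition (w w₀ = v ⇔ w = v w₀), and 0 otherwise.
𝒦 : ∀ {m} → (Exp (suc m) → Perm (suc m) → Series (suc m)) → TAlg m
𝒦 K β v = if isPartition β then K β (v · w₀) else zeroS

-- Write 𝒦 = Σ_v A_v ε_v with A_v = π_{v w₀} x^β (and A = 0 off partitions). Right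
-- multiplication by w₀ exchanges left ascents and left descents, so:
-- * if ℓ(s_i v) > ℓ(v), then s_i is a left descent of v w₀, π_{v w₀} = π_i π_{s_i v w₀}, and
--   π_i A_v = A_v because π_i is idempotent, while the ε_v-coefficient of ε_i 𝒦 is 0;
-- * if ℓ(s_i v) < ℓ(v), then π_i A_v = π_{s_i v w₀} x^β = A_{s_i v}, while the
--   ε_v-coefficient of ε_i 𝒦 is A_{s_i v} - A_v.
-- Idempotence of π_i is checked in the two variables x_i, x_{i+1}: the coefficient of
-- x^a y^b in π F is symmetric in a and b, and π fixes symmetric series. Lengths are
-- counted by inversions, exactly one of which changes under w ↦ s_i w.
module Submission where

open import Defs
open import Data.Bool using (true; false; T; if_then_else_; _∧_)
open import Data.Bool.Properties using (∧-zeroʳ)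
open import Data.Fin as Fin using (Fin; inject₁; toℕ)
open import Data.Fin.Permutation using (_⟨$⟩ʳ_; _⟨$⟩ˡ_; inverseˡ; inverseʳ; _≈_)
import Data.Fin.Permutation.Components as PC
import Data.Fin.Properties as FinP
open import Data.Fin.Properties using (toℕ-inject₁; toℕ-injective; punchInᵢ≢i; any?; all?) renaming (_≟_ to _≟ᶠ_)
open import Data.Integer using (ℤ; 0ℤ; 1ℤ; -1ℤ; _+_; _-_; _*_)
import Data.Integer.Properties as ℤP
open import Data.Integer.Tactic.RingSolver using (solve-∀)
open import Data.List as List using (List; []; _∷_; applyUpTo)
open import Data.Nat as ℕ using (ℕ; zero; suc; pred; _∸_)
open import Data.Nat.ListAction using () renaming (sum to sumℕ)
import Data.Nat.Properties as ℕP
open import Algebra.Properties.CommutativeMonoid.Sum ℕP.+-0-commutativeMonoid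
  using (sum; sum-remove; sum-cong-≗; sum-replicate-zero)
open import Data.Product using (_×_; _,_; ∃-syntax)
open import Data.Sum using (_⊎_; inj₁; inj₂)
open import Data.Vec using (lookup; tabulate; updateAt)
open import Data.Vec.Functional using (removeAt)
open import Data.Vec.Properties using (lookup∘updateAt; lookup∘updateAt′; lookup∘tabulate; tabulate∘lookup; tabulate-cong)
open import Function using (_∘_; _$_; id; const; _⇔_; mk⇔)
open import Relation.Binary.Definitions using (tri<; tri≈; tri>)
open import Relation.Binary.PropositionalEquality hiding (J)
open import Relation.Nullary using (¬_; Dec; yes; no; does)
open import Relation.Nullary.Decidable using (dec-true; dec-false; does-⇔; _×-dec_; T?)
open import Relation.Nullary.Negation using (contradiction)

-- The Demazure operator in two variables

sumBelow : ℕ → (ℕ → ℤ) → ℤ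
sumBelow zero    f = 0ℤ
sumBelow (suc n) f = f 0 + sumBelow n (f ∘ suc)

sumℤ-map-applyUpTo : ∀ (f : ℕ → ℤ) g n → sumℤ (List.map f (applyUpTo g n)) ≡ sumBelow n (f ∘ g)
sumℤ-map-applyUpTo f g zero    = refl
sumℤ-map-applyUpTo f g (suc n) = cong (f (g 0) +_) (sumℤ-map-applyUpTo f (g ∘ suc) n)

sumBelow-cong : ∀ {f g : ℕ → ℤ} n → (∀ k → f k ≡ g k) → sumBelow n f ≡ sumBelow n g
sumBelow-cong zero    f≗g = refl
sumBelow-cong (suc n) f≗g = cong₂ _+_ (f≗g 0) (sumBelow-cong n (f≗g ∘ suc))

sumBelow-suc : ∀ (f : ℕ → ℤ) n → sumBelow (suc n) f ≡ sumBelow n f + f n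
sumBelow-suc f zero    = ℤP.+-comm (f 0) 0ℤ
sumBelow-suc f (suc n) = begin
  f 0 + sumBelow (suc n) (f ∘ suc)        ≡⟨ cong (f 0 +_) (sumBelow-suc (f ∘ suc) n) ⟩
  f 0 + (sumBelow n (f ∘ suc) + f (suc n)) ≡⟨ ℤP.+-assoc (f 0) _ _ ⟨
  sumBelow (suc n) f + f (suc n)           ∎
  where open ≡-Reasoning

Series₂ : Set
Series₂ = ℕ → ℕ → ℤ

mulx₂ : Series₂ → Series₂
mulx₂ F zero    y = 0ℤ
mulx₂ F (suc x) y = F x y

-- πD on series F in two variables x, y, where F a b is the coefficient of x^a y^b; the
-- formula is that of divDiff applied to mulX.
π₂ : Series₂ → Series₂
π₂ F x y = sumBelow (suc y) λ k → mulx₂ F (x ℕ.+ suc k) (y ∸ k) - mulx₂ F (y ∸ k) (x ℕ.+ suc k)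

Symmetric₂ : Series₂ → Set
Symmetric₂ F = ∀ x y → F x y ≡ F y x

π₂-cong : ∀ {F G} → (∀ x y → F x y ≡ G x y) → ∀ x y → π₂ F x y ≡ π₂ G x y
π₂-cong {F} {G} F≗G x y = sumBelow-cong (suc y) λ k →
  cong₂ _-_ (mulx₂-cong (x ℕ.+ suc k) (y ∸ k)) (mulx₂-cong (y ∸ k) (x ℕ.+ suc k))
  where
  mulx₂-cong : ∀ a b → mulx₂ F a b ≡ mulx₂ G a b
  mulx₂-cong zero    b = refl
  mulx₂-cong (suc a) b = F≗G a b

π₂-zero : ∀ F x → π₂ F x 0 ≡ F x 0
π₂-zero F x rewrite ℕP.+-comm x 1 = trans (ℤP.+-identityʳ _) (ℤP.+-identityʳ (F x 0))

π₂-suc : ∀ F x y → π₂ F x (suc y) ≡ (F x (suc y) - F y (suc x)) + π₂ F (suc x) y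
π₂-suc F x y = cong₂ _+_ first-term $ sumBelow-cong (suc y) λ k →
  cong (λ a → mulx₂ F a (y ∸ k) - mulx₂ F (y ∸ k) a) (ℕP.+-suc x (suc k))
  where
  first-term : mulx₂ F (x ℕ.+ 1) (suc y) - mulx₂ F (suc y) (x ℕ.+ 1) ≡ F x (suc y) - F y (suc x)
  first-term rewrite ℕP.+-comm x 1 = refl

antidiagonalSum : Series₂ → ℕ → ℕ → ℤ
antidiagonalSum F d c = sumBelow c λ p → F p (d ∸ p)

-- π(x^a y^b) is the signed sum of the monomials of degree a + b between x^a y^b and x^b y^a,
-- so the coefficient of x^x y^y in π₂ F only involves F on the antidiagonal of degree x + y.

π₂-antidiagonal : ∀ F x y d → x ℕ.+ y ≡ d → let A = antidiagonalSum F d in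
                  π₂ F x y ≡ (A (suc d) - A x) - A y
π₂-antidiagonal F x zero d refl rewrite ℕP.+-identityʳ x = begin
  π₂ F x 0                          ≡⟨ π₂-zero F x ⟩
  F x 0                             ≡⟨ cong (F x) (ℕP.n∸n≡0 x) ⟨
  F x (x ∸ x)                       ≡⟨ cancel (A x) (F x (x ∸ x)) ⟩
  ((A x + F x (x ∸ x)) - A x) - 0ℤ  ≡⟨ cong (λ z → (z - A x) - 0ℤ) (sumBelow-suc _ x) ⟨
  (A (suc x) - A x) - A 0           ∎
  where
  open ≡-Reasoning
  A = antidiagonalSum F x
  cancel : ∀ a b → b ≡ ((a + b) - a) - 0ℤ
  cancel = solve-∀
π₂-antidiagonal F x (suc y) d x+[1+y]≡d = begin
  π₂ F x (suc y)
    ≡⟨ π₂-suc F x y ⟩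
  (F x (suc y) - F y (suc x)) + π₂ F (suc x) y
    ≡⟨ cong ((F x (suc y) - F y (suc x)) +_) (π₂-antidiagonal F (suc x) y d (trans (sym (ℕP.+-suc x y)) x+[1+y]≡d)) ⟩
  (F x (suc y) - F y (suc x)) + ((A (suc d) - A (suc x)) - A y)
    ≡⟨ cong₂ (λ u v → (F x u - F y v) + ((A (suc d) - A (suc x)) - A y)) d∸x≡1+y d∸y≡1+x ⟨
  (Fx - Fy) + ((A (suc d) - A (suc x)) - A y)
    ≡⟨ cong (λ z → (Fx - Fy) + ((A (suc d) - z) - A y)) (sumBelow-suc _ x) ⟩
  (Fx - Fy) + ((A (suc d) - (A x + Fx)) - A y)
    ≡⟨ regroup Fx Fy (A (suc d)) (A x) (A y) ⟩
  (A (suc d) - A x) - (A y + Fy)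
    ≡⟨ cong (λ z → (A (suc d) - A x) - z) (sumBelow-suc _ y) ⟨
  (A (suc d) - A x) - A (suc y)
    ∎
  where
  open ≡-Reasoning
  A = antidiagonalSum F d
  Fx = F x (d ∸ x)
  Fy = F y (d ∸ y)
  y+[1+x]≡d : y ℕ.+ suc x ≡ d
  y+[1+x]≡d = trans (ℕP.+-suc y x) (trans (cong suc (ℕP.+-comm y x)) (trans (sym (ℕP.+-suc x y)) x+[1+y]≡d))
  d∸x≡1+y : d ∸ x ≡ suc y
  d∸x≡1+y = trans (cong (_∸ x) (sym x+[1+y]≡d)) (ℕP.m+n∸m≡n x (suc y))
  d∸y≡1+x : d ∸ y ≡ suc x
  d∸y≡1+x = trans (cong (_∸ y) (sym y+[1+x]≡d)) (ℕP.m+n∸m≡n y (suc x))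
  regroup : ∀ a b t tx ty → (a - b) + ((t - (tx + a)) - ty) ≡ (t - tx) - (ty + b)
  regroup = solve-∀

π₂-symmetric : ∀ F → Symmetric₂ (π₂ F)
π₂-symmetric F x y = begin
  π₂ F x y                  ≡⟨ π₂-antidiagonal F x y (x ℕ.+ y) refl ⟩
  (A (suc d) - A x) - A y   ≡⟨ swap (A (suc d)) (A x) (A y) ⟩
  (A (suc d) - A y) - A x   ≡⟨ π₂-antidiagonal F y x (x ℕ.+ y) (ℕP.+-comm y x) ⟨
  π₂ F y x                  ∎
  where
  open ≡-Reasoning
  d = x ℕ.+ y
  A = antidiagonalSum F d
  swap : ∀ t a b → (t - a) - b ≡ (t - b) - a
  swap = solve-∀

π₂-fixes-symmetric : ∀ G → Symmetric₂ G → ∀ x y → π₂ G x y ≡ G x y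
π₂-fixes-symmetric G sym-G x zero    = π₂-zero G x
π₂-fixes-symmetric G sym-G x (suc y) = begin
  π₂ G x (suc y)                                   ≡⟨ π₂-suc G x y ⟩
  (G x (suc y) - G y (suc x)) + π₂ G (suc x) y
    ≡⟨ cong₂ (λ a b → (G x (suc y) - a) + b) (sym-G y (suc x)) (π₂-fixes-symmetric G sym-G (suc x) y) ⟩
  (G x (suc y) - G (suc x) y) + G (suc x) y         ≡⟨ cancel (G x (suc y)) (G (suc x) y) ⟩
  G x (suc y)                                      ∎
  where
  open ≡-Reasoning
  cancel : ∀ a b → (a - b) + b ≡ a
  cancel = solve-∀

π₂-idempotent : ∀ F x y → π₂ (π₂ F) x y ≡ π₂ F x y
π₂-idempotent F = π₂-fixes-symmetric (π₂ F) (π₂-symmetric F)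

-- Restriction to the (x_i, x_{i+1})-plane

transpose-matchˡ : ∀ {n} (a b : Fin n) → PC.transpose a b a ≡ b
transpose-matchˡ a b rewrite dec-true (a ≟ᶠ a) refl = refl

transpose-matchʳ : ∀ {n} (a b : Fin n) → PC.transpose a b b ≡ a
transpose-matchʳ a b with b ≟ᶠ a
... | yes b≡a = b≡a
... | no _ rewrite dec-true (b ≟ᶠ b) refl = refl

transpose-other : ∀ {n} {a b k : Fin n} → k ≢ a → k ≢ b → PC.transpose a b k ≡ k
transpose-other {a = a} {b} {k} k≢a k≢b rewrite dec-false (k ≟ᶠ a) k≢a | dec-false (k ≟ᶠ b) k≢b = refl

transpose-involutive : ∀ {n} (a b k : Fin n) → PC.transpose a b (PC.transpose a b k) ≡ k
transpose-involutive a b k = involution (k ≟ᶠ a) (k ≟ᶠ b)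
  where
  τ = PC.transpose a b
  involution : Dec (k ≡ a) → Dec (k ≡ b) → τ (τ k) ≡ k
  involution (yes refl) _        = trans (cong τ (transpose-matchˡ k b)) (transpose-matchʳ k b)
  involution (no _)    (yes refl) = trans (cong τ (transpose-matchʳ a k)) (transpose-matchˡ a k)
  involution (no k≢a)  (no k≢b)   = trans (cong τ (transpose-other k≢a k≢b)) (transpose-other k≢a k≢b)

module Adjacent {m : ℕ} (i : Fin m) where
  I J : Fin (suc m)
  I = inject₁ i
  J = Fin.suc i

  I<J : I Fin.< J
  I<J rewrite toℕ-inject₁ i = ℕP.n<1+n (toℕ i)

  I≢J : I ≢ J
  I≢J I≡J = ℕP.<-irrefl (cong toℕ I≡J) I<J

module Slice {m : ℕ} (i : Fin m) where
  open Adjacent i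

  set : Exp (suc m) → ℕ → ℕ → Exp (suc m)
  set α X Y = updateAt (updateAt α I (const X)) J (const Y)

  lookup-set-I : ∀ α X Y → lookup (set α X Y) I ≡ X
  lookup-set-I α X Y = trans (lookup∘updateAt′ I J I≢J (updateAt α I (const X))) (lookup∘updateAt I α)

  lookup-set-J : ∀ α X Y → lookup (set α X Y) J ≡ Y
  lookup-set-J α X Y = lookup∘updateAt J (updateAt α I (const X))

  lookup-set-other : ∀ α X Y {k} → k ≢ I → k ≢ J → lookup (set α X Y) k ≡ lookup α k
  lookup-set-other α X Y {k} k≢I k≢J =
    trans (lookup∘updateAt′ k J k≢J (updateAt α I (const X))) (lookup∘updateAt′ k I k≢I α)

  ≡-set : ∀ {γ} α X Y → lookup γ I ≡ X → lookup γ J ≡ Y →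
          (∀ {k} → k ≢ I → k ≢ J → lookup γ k ≡ lookup α k) → γ ≡ set α X Y
  ≡-set {γ} α X Y γI≡X γJ≡Y γ≗α = begin
    γ                              ≡⟨ tabulate∘lookup γ ⟨
    tabulate (lookup γ)            ≡⟨ tabulate-cong pointwise ⟩
    tabulate (lookup (set α X Y))  ≡⟨ tabulate∘lookup (set α X Y) ⟩
    set α X Y                      ∎
    where
    open ≡-Reasoning
    pointwise : ∀ k → lookup γ k ≡ lookup (set α X Y) k
    pointwise k with k ≟ᶠ I | k ≟ᶠ J
    ... | yes refl | _        = trans γI≡X (sym (lookup-set-I α X Y))
    ... | no _     | yes refl = trans γJ≡Y (sym (lookup-set-J α X Y))
    ... | no k≢I   | no k≢J   = trans (γ≗α k≢I k≢J) (sym (lookup-set-other α X Y k≢I k≢J))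

  set-set : ∀ α X Y X′ Y′ → set (set α X Y) X′ Y′ ≡ set α X′ Y′
  set-set α X Y X′ Y′ = ≡-set α X′ Y′ (lookup-set-I (set α X Y) X′ Y′) (lookup-set-J (set α X Y) X′ Y′)
    λ k≢I k≢J → trans (lookup-set-other (set α X Y) X′ Y′ k≢I k≢J) (lookup-set-other α X Y k≢I k≢J)

  updateAt²≡set : ∀ α (f g : ℕ → ℕ) → updateAt (updateAt α I f) J g ≡ set α (f (lookup α I)) (g (lookup α J))
  updateAt²≡set α f g = ≡-set α _ _
    (trans (lookup∘updateAt′ I J I≢J (updateAt α I f)) (lookup∘updateAt I α))
    (trans (lookup∘updateAt J (updateAt α I f)) (cong g (lookup∘updateAt′ J I (I≢J ∘ sym) α)))
    λ k≢I k≢J → trans (lookup∘updateAt′ _ J k≢J (updateAt α I f)) (lookup∘updateAt′ _ I k≢I α)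

  updateAt-pred-set : ∀ α X Y → updateAt (set α X Y) I pred ≡ set α (pred X) Y
  updateAt-pred-set α X Y = ≡-set α _ _
    (trans (lookup∘updateAt I (set α X Y)) (cong pred (lookup-set-I α X Y)))
    (trans (lookup∘updateAt′ J I (I≢J ∘ sym) (set α X Y)) (lookup-set-J α X Y))
    λ k≢I k≢J → trans (lookup∘updateAt′ _ I k≢I (set α X Y)) (lookup-set-other α X Y k≢I k≢J)

  swap-set : ∀ α X Y → tabulate (lookup (set α X Y) ∘ PC.transpose I J) ≡ set α Y X
  swap-set α X Y = ≡-set α Y X
    (trans (lookup∘tabulate swapped I) (trans (cong (lookup (set α X Y)) (transpose-matchˡ I J)) (lookup-set-J α X Y)))
    (trans (lookup∘tabulate swapped J) (trans (cong (lookup (set α X Y)) (transpose-matchʳ I J)) (lookup-set-I α X Y)))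
    λ {k} k≢I k≢J → trans (lookup∘tabulate swapped k)
      (trans (cong (lookup (set α X Y)) (transpose-other k≢I k≢J)) (lookup-set-other α X Y k≢I k≢J))
    where
    swapped : Fin (suc m) → ℕ
    swapped = lookup (set α X Y) ∘ PC.transpose I J

  -- πD i never changes the exponents away from I and J, so it acts on each slice separately.
  slice : Series (suc m) → Exp (suc m) → Series₂
  slice f α X Y = f (set α X Y)

  mulX-set : ∀ f α X Y → mulX I f (set α X Y) ≡ mulx₂ (slice f α) X Y
  mulX-set f α X Y with lookup (set α X Y) I | lookup-set-I α X Y
  ... | zero  | refl = refl
  ... | suc _ | refl = cong f (updateAt-pred-set α X Y)

  πD-slice : ∀ f α → πD i f α ≡ π₂ (slice f α) (lookup α I) (lookup α J)
  πD-slice f α = trans (sumℤ-map-applyUpTo term id (suc y)) $ sumBelow-cong (suc y) λ k →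
    trans (cong h (updateAt²≡set α (ℕ._+ suc k) (_∸ k)))
          (cong₂ _-_ (mulX-set f α (x ℕ.+ suc k) (y ∸ k))
                     (trans (cong (mulX I f) (swap-set α (x ℕ.+ suc k) (y ∸ k))) (mulX-set f α (y ∸ k) (x ℕ.+ suc k))))
    where
    x = lookup α I
    y = lookup α J
    h : Series (suc m)
    h = mulX I f -S sS i (mulX I f)
    term : ℕ → ℤ
    term k = h (updateAt (updateAt α I (ℕ._+ suc k)) J (_∸ k))

  πD-cong : ∀ f g → (∀ γ → f γ ≡ g γ) → ∀ α → πD i f α ≡ πD i g α
  πD-cong f g f≗g α = begin
    πD i f α                                  ≡⟨ πD-slice f α ⟩
    π₂ (slice f α) (lookup α I) (lookup α J)  ≡⟨ π₂-cong (λ X Y → f≗g (set α X Y)) (lookup α I) (lookup α J) ⟩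
    π₂ (slice g α) (lookup α I) (lookup α J)  ≡⟨ πD-slice g α ⟨
    πD i g α                                  ∎
    where open ≡-Reasoning

  πD-idempotent : ∀ f α → πD i (πD i f) α ≡ πD i f α
  πD-idempotent f α = begin
    πD i (πD i f) α                                     ≡⟨ πD-slice (πD i f) α ⟩
    π₂ (slice (πD i f) α) (lookup α I) (lookup α J)     ≡⟨ π₂-cong slice-πD (lookup α I) (lookup α J) ⟩
    π₂ (π₂ (slice f α)) (lookup α I) (lookup α J)       ≡⟨ π₂-idempotent (slice f α) (lookup α I) (lookup α J) ⟩
    π₂ (slice f α) (lookup α I) (lookup α J)            ≡⟨ πD-slice f α ⟨
    πD i f α                                            ∎
    where
    open ≡-Reasoning
    slice-πD : ∀ X Y → πD i f (set α X Y) ≡ π₂ (slice f α) X Y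
    slice-πD X Y = begin
      πD i f (set α X Y)                                       ≡⟨ πD-slice f (set α X Y) ⟩
      π₂ (slice f (set α X Y)) (lookup (set α X Y) I) (lookup (set α X Y) J)
        ≡⟨ cong₂ (π₂ (slice f (set α X Y))) (lookup-set-I α X Y) (lookup-set-J α X Y) ⟩
      π₂ (slice f (set α X Y)) X Y
        ≡⟨ π₂-cong (λ X′ Y′ → cong f (set-set α X Y X′ Y′)) X Y ⟩
      π₂ (slice f α) X Y                                       ∎

  πD-zero : ∀ α → πD i zeroS α ≡ 0ℤ
  πD-zero α = trans (πD-slice zeroS α) (π₂-fixes-symmetric (λ _ _ → 0ℤ) (λ _ _ → refl) (lookup α I) (lookup α J))

πWord-zero : ∀ {m} (ws : List (Fin m)) α → πWord ws zeroS α ≡ 0ℤ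
πWord-zero []       α = refl
πWord-zero (i ∷ ws) α = trans (Slice.πD-cong i (πWord ws zeroS) zeroS (πWord-zero ws) α) (Slice.πD-zero i α)

-- Lengths and inversions

sumℕ-map-tabulate : ∀ {n} {A : Set} (f : A → ℕ) (g : Fin n → A) → sumℕ (List.map f (List.tabulate g)) ≡ sum (f ∘ g)
sumℕ-map-tabulate {zero}  f g = refl
sumℕ-map-tabulate {suc n} f g = cong (f (g Fin.zero) ℕ.+_) (sumℕ-map-tabulate f (g ∘ Fin.suc))

sum-suc-at : ∀ {n} (t u : Fin n → ℕ) a → t a ≡ suc (u a) → (∀ {b} → b ≢ a → t b ≡ u b) → sum t ≡ suc (sum u)
sum-suc-at {suc n} t u a ta≡1+ua t≗u = begin
  sum t                              ≡⟨ sum-remove t ⟩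
  t a ℕ.+ sum (removeAt t a)         ≡⟨ cong₂ ℕ._+_ ta≡1+ua (sum-cong-≗ (λ b → t≗u (punchInᵢ≢i a b))) ⟩
  suc (u a ℕ.+ sum (removeAt u a))   ≡⟨ cong suc (sum-remove u) ⟨
  suc (sum u)                        ∎
  where open ≡-Reasoning

inversion : ∀ {n} → Perm n → Fin n → Fin n → ℕ
inversion w a b = if does (toℕ a ℕ.<? toℕ b) ∧ does (toℕ (w ⟨$⟩ʳ b) ℕ.<? toℕ (w ⟨$⟩ʳ a)) then 1 else 0

ℓ≡sum-inversion : ∀ {n} (w : Perm n) → ℓ w ≡ sum λ a → sum (inversion w a)
ℓ≡sum-inversion {n} w = trans (sumℕ-map-tabulate {n} _ id) (sum-cong-≗ λ a → sumℕ-map-tabulate (inversion w a) id)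

inversion-≡1 : ∀ {n} (w : Perm n) {a b} → a Fin.< b → w ⟨$⟩ʳ b Fin.< w ⟨$⟩ʳ a → inversion w a b ≡ 1
inversion-≡1 w {a} {b} a<b wb<wa
  rewrite dec-true (toℕ a ℕ.<? toℕ b) a<b | dec-true (toℕ (w ⟨$⟩ʳ b) ℕ.<? toℕ (w ⟨$⟩ʳ a)) wb<wa = refl

inversion-≡0ˡ : ∀ {n} (w : Perm n) {a b} → ¬ a Fin.< b → inversion w a b ≡ 0
inversion-≡0ˡ w {a} {b} a≮b rewrite dec-false (toℕ a ℕ.<? toℕ b) a≮b = refl

inversion-≡0ʳ : ∀ {n} (w : Perm n) {a b} → ¬ w ⟨$⟩ʳ b Fin.< w ⟨$⟩ʳ a → inversion w a b ≡ 0
inversion-≡0ʳ w {a} {b} wb≮wa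
  rewrite dec-false (toℕ (w ⟨$⟩ʳ b) ℕ.<? toℕ (w ⟨$⟩ʳ a)) wb≮wa | ∧-zeroʳ (does (toℕ a ℕ.<? toℕ b)) = refl

ℓ-cong : ∀ {n} {u v : Perm n} → u ≈ v → ℓ u ≡ ℓ v
ℓ-cong {u = u} {v} u≈v = begin
  ℓ u                              ≡⟨ ℓ≡sum-inversion u ⟩
  sum (λ a → sum (inversion u a))
    ≡⟨ sum-cong-≗ (λ a → sum-cong-≗ λ b → cong₂ (inversionAt a b) (u≈v a) (u≈v b)) ⟩
  sum (λ a → sum (inversion v a))  ≡⟨ ℓ≡sum-inversion v ⟨
  ℓ v                              ∎
  where
  open ≡-Reasoning
  inversionAt : ∀ {n} → Fin n → Fin n → Fin n → Fin n → ℕ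
  inversionAt a b wa wb = if does (toℕ a ℕ.<? toℕ b) ∧ does (toℕ wb ℕ.<? toℕ wa) then 1 else 0

ℓ-id : ∀ {n} → ℓ (idP {n}) ≡ 0
ℓ-id {n} = trans (ℓ≡sum-inversion (idP {n})) $
  trans (sum-cong-≗ λ a → trans (sum-cong-≗ (no-inversion a)) (sum-replicate-zero n)) (sum-replicate-zero n)
  where
  no-inversion : ∀ a b → inversion (idP {n}) a b ≡ 0
  no-inversion a b with a Fin.<? b
  ... | yes a<b = inversion-≡0ʳ idP (FinP.<-asym a<b)
  ... | no a≮b  = inversion-≡0ˡ idP a≮b

-- By ℓ-ascent and ℓ-descent, LeftDescent i w means ℓ (s i · w) < ℓ w.
LeftAscent : ∀ {m} → Fin m → Perm (suc m) → Set
LeftAscent i w = w ⟨$⟩ˡ inject₁ i Fin.< w ⟨$⟩ˡ Fin.suc i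

LeftDescent : ∀ {m} → Fin m → Perm (suc m) → Set
LeftDescent i w = w ⟨$⟩ˡ Fin.suc i Fin.< w ⟨$⟩ˡ inject₁ i

opposite-< : ∀ {n} {x y : Fin n} → x Fin.< y → Fin.opposite y Fin.< Fin.opposite x
opposite-< {n} {x} {y} x<y rewrite FinP.opposite-prop x | FinP.opposite-prop y = ℕP.∸-monoʳ-< (ℕ.s≤s x<y) (FinP.toℕ<n y)

module AdjacentTransposition {m : ℕ} (i : Fin m) where
  open Adjacent i

  t : Fin (suc m) → Fin (suc m)
  t = PC.transpose I J

  data Position (z : Fin (suc m)) : Set where
    at-I : z ≡ I → Position z
    at-J : z ≡ J → Position z
    away : z ≢ I → z ≢ J → Position z

  position : ∀ z → Position z
  position z with z ≟ᶠ I | z ≟ᶠ J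
  ... | yes z≡I | _       = at-I z≡I
  ... | no _    | yes z≡J = at-J z≡J
  ... | no z≢I  | no z≢J  = away z≢I z≢J

  I<⇒J≤ : ∀ {x : Fin (suc m)} → I Fin.< x → J Fin.≤ x
  I<⇒J≤ I<x rewrite toℕ-inject₁ i = I<x

  <J⇒≤I : ∀ {y : Fin (suc m)} → y Fin.< J → y Fin.≤ I
  <J⇒≤I y<J rewrite toℕ-inject₁ i = ℕ.s≤s⁻¹ y<J

  -- No index lies strictly between I and J, so swapping them preserves every other comparison.
  t-mono : ∀ {y x} → y Fin.< x → ¬ (y ≡ I × x ≡ J) → t y Fin.< t x
  t-mono {y} {x} y<x y,x≢I,J with position y | position x
  ... | at-I refl | at-I refl = contradiction y<x (ℕP.<-irrefl refl)
  ... | at-I refl | at-J refl = contradiction (refl , refl) y,x≢I,J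
  ... | at-I refl | away x≢I x≢J
    rewrite transpose-matchˡ I J | transpose-other x≢I x≢J = FinP.≤∧≢⇒< (I<⇒J≤ y<x) (x≢J ∘ sym)
  ... | at-J refl | at-I refl = contradiction y<x (ℕP.<-asym I<J)
  ... | at-J refl | at-J refl = contradiction y<x (ℕP.<-irrefl refl)
  ... | at-J refl | away x≢I x≢J
    rewrite transpose-matchʳ I J | transpose-other x≢I x≢J = ℕP.<-trans I<J y<x
  ... | away y≢I y≢J | at-I refl
    rewrite transpose-other y≢I y≢J | transpose-matchˡ I J = ℕP.<-trans y<x I<J
  ... | away y≢I y≢J | at-J refl
    rewrite transpose-other y≢I y≢J | transpose-matchʳ I J = FinP.≤∧≢⇒< (<J⇒≤I y<x) y≢I
  ... | away y≢I y≢J | away x≢I x≢J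
    rewrite transpose-other y≢I y≢J | transpose-other x≢I x≢J = y<x

  t≡I⇒≡J : ∀ {y} → t y ≡ I → y ≡ J
  t≡I⇒≡J {y} ty≡I = trans (sym (transpose-involutive I J y)) (trans (cong t ty≡I) (transpose-matchˡ I J))

  t≡J⇒≡I : ∀ {x} → t x ≡ J → x ≡ I
  t≡J⇒≡I {x} tx≡J = trans (sym (transpose-involutive I J x)) (trans (cong t tx≡J) (transpose-matchʳ I J))

  t-<-⇔ : ∀ {y x} → ¬ (y ≡ I × x ≡ J) → ¬ (y ≡ J × x ≡ I) → (t y Fin.< t x ⇔ y Fin.< x)
  t-<-⇔ {y} {x} ≢I,J ≢J,I = mk⇔ reflect (λ y<x → t-mono y<x ≢I,J)
    where
    reflect : t y Fin.< t x → y Fin.< x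
    reflect ty<tx = subst₂ Fin._<_ (transpose-involutive I J y) (transpose-involutive I J x)
      (t-mono ty<tx λ (ty≡I , tx≡J) → ≢J,I (t≡I⇒≡J ty≡I , t≡J⇒≡I tx≡J))

  module _ (w : Perm (suc m)) where
    p q : Fin (suc m)
    p = w ⟨$⟩ˡ I
    q = w ⟨$⟩ˡ J

    ≡-preimage : ∀ {a z} → w ⟨$⟩ʳ a ≡ z → a ≡ w ⟨$⟩ˡ z
    ≡-preimage {a} wa≡z = trans (sym (inverseˡ w)) (cong (w ⟨$⟩ˡ_) wa≡z)

    inversion-s-away : ∀ {a b} → ¬ (a ≡ p × b ≡ q) → ¬ (a ≡ q × b ≡ p) →
                       inversion (s i · w) a b ≡ inversion w a b
    inversion-s-away {a} {b} ab≢pq ab≢qp = cong (λ c → if does (toℕ a ℕ.<? toℕ b) ∧ c then 1 else 0)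
      (does-⇔ (t-<-⇔ (λ (wb≡I , wa≡J) → ab≢qp (≡-preimage wa≡J , ≡-preimage wb≡I))
                     (λ (wb≡J , wa≡I) → ab≢pq (≡-preimage wa≡I , ≡-preimage wb≡J)))
              (toℕ (t (w ⟨$⟩ʳ b)) ℕ.<? toℕ (t (w ⟨$⟩ʳ a))) (toℕ (w ⟨$⟩ʳ b) ℕ.<? toℕ (w ⟨$⟩ʳ a)))

    inversion-s : p Fin.< q → ∀ {a b} → ¬ (a ≡ p × b ≡ q) → inversion (s i · w) a b ≡ inversion w a b
    inversion-s p<q {a} {b} ab≢pq with (a ≟ᶠ q) ×-dec (b ≟ᶠ p)
    ... | yes (refl , refl) = trans (inversion-≡0ˡ (s i · w) (ℕP.<-asym p<q)) (sym (inversion-≡0ˡ w (ℕP.<-asym p<q)))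
    ... | no ab≢qp          = inversion-s-away ab≢pq ab≢qp

    ℓ-ascent : LeftAscent i w → ℓ (s i · w) ≡ suc (ℓ w)
    ℓ-ascent p<q = begin
      ℓ (s i · w)                              ≡⟨ ℓ≡sum-inversion (s i · w) ⟩
      sum (λ a → sum (inversion (s i · w) a))
        ≡⟨ sum-suc-at (sum ∘ inversion (s i · w)) (sum ∘ inversion w) p row-p other-row ⟩
      suc (sum (λ a → sum (inversion w a)))    ≡⟨ cong suc (ℓ≡sum-inversion w) ⟨
      suc (ℓ w)                                ∎
      where
      open ≡-Reasoning
      tJ<tI : t (w ⟨$⟩ʳ q) Fin.< t (w ⟨$⟩ʳ p)
      tJ<tI = subst₂ Fin._<_ (sym (trans (cong t (inverseʳ w)) (transpose-matchʳ I J)))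
                             (sym (trans (cong t (inverseʳ w)) (transpose-matchˡ I J))) I<J
      J≮I : ¬ w ⟨$⟩ʳ q Fin.< w ⟨$⟩ʳ p
      J≮I J<I = ℕP.<-asym I<J (subst₂ Fin._<_ (inverseʳ w) (inverseʳ w) J<I)
      new-inversion : inversion (s i · w) p q ≡ suc (inversion w p q)
      new-inversion = trans (inversion-≡1 (s i · w) p<q tJ<tI) (cong suc (sym (inversion-≡0ʳ w J≮I)))
      row-p : sum (inversion (s i · w) p) ≡ suc (sum (inversion w p))
      row-p = sum-suc-at (inversion (s i · w) p) (inversion w p) q new-inversion
        λ b≢q → inversion-s p<q λ (_ , b≡q) → b≢q b≡q
      other-row : ∀ {a} → a ≢ p → sum (inversion (s i · w) a) ≡ sum (inversion w a)
      other-row {a} a≢p = sum-cong-≗ {x = inversion (s i · w) a} {y = inversion w a}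
        λ b → inversion-s p<q λ (a≡p , _) → a≢p a≡p

  s-involutive : ∀ w → s i · (s i · w) ≈ w
  s-involutive w x = transpose-involutive I J (w ⟨$⟩ʳ x)

  ℓ-s-s : ∀ w → ℓ (s i · (s i · w)) ≡ ℓ w
  ℓ-s-s w = ℓ-cong {u = s i · (s i · w)} {v = w} (s-involutive w)

  ℓ-descent : ∀ w → LeftDescent i w → ℓ w ≡ suc (ℓ (s i · w))
  ℓ-descent w q<p = trans (sym (ℓ-s-s w)) (ℓ-ascent (s i · w) ascent)
    where
    ascent : LeftAscent i (s i · w)
    ascent = subst₂ Fin._<_ (cong (w ⟨$⟩ˡ_) (sym (transpose-matchʳ J I)))
                            (cong (w ⟨$⟩ˡ_) (sym (transpose-matchˡ J I))) q<p

  Reduced-∷-ascent : ∀ {ws} w → LeftAscent i w → Reduced ws w → Reduced (i ∷ ws) (s i · w)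
  Reduced-∷-ascent w ascent (length≡ℓ , ws≈w) =
    trans (cong suc length≡ℓ) (sym (ℓ-ascent w ascent)) , λ x → cong t (ws≈w x)

  Reduced-∷-descent : ∀ {ws} w → LeftDescent i w → Reduced ws (s i · w) → Reduced (i ∷ ws) w
  Reduced-∷-descent w descent (length≡ℓ , ws≈s·w) =
    trans (cong suc length≡ℓ) (sym (ℓ-descent w descent)) , λ x → trans (cong t (ws≈s·w x)) (s-involutive w x)

  s·w≉w : ∀ w → (s i · w) ≈? w ≡ false
  s·w≉w w = dec-false (all? λ x → (s i · w) ⟨$⟩ʳ x ≟ᶠ w ⟨$⟩ʳ x) λ s·w≈w →
    I≢J (sym (trans (sym (trans (cong t (inverseʳ w)) (transpose-matchˡ I J))) (trans (s·w≈w (w ⟨$⟩ˡ I)) (inverseʳ w))))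

  -- (w · w₀)⁻¹ is definitionally opposite ∘ w⁻¹.
  ascent⇒descent-·w₀ : ∀ w → LeftAscent i w → LeftDescent i (w · w₀)
  ascent⇒descent-·w₀ w = opposite-<

  descent⇒ascent-·w₀ : ∀ w → LeftDescent i w → LeftAscent i (w · w₀)
  descent⇒ascent-·w₀ w = opposite-<

  ascent-or-descent : ∀ w → LeftAscent i w ⊎ LeftDescent i w
  ascent-or-descent w with FinP.<-cmp (w ⟨$⟩ˡ I) (w ⟨$⟩ˡ J)
  ... | tri< p<q _ _ = inj₁ p<q
  ... | tri≈ _ p≡q _ = contradiction (trans (sym (inverseʳ w)) (trans (cong (w ⟨$⟩ʳ_) p≡q) (inverseʳ w))) I≢J
  ... | tri> _ _ q<p = inj₂ q<p

-- Reduced words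

Reduced-resp-≈ : ∀ {m} {ws : List (Fin m)} {u v} → u ≈ v → Reduced ws u → Reduced ws v
Reduced-resp-≈ {u = u} {v} u≈v (length≡ℓ , ws≈u) =
  trans length≡ℓ (ℓ-cong {u = u} {v} u≈v) , λ x → trans (ws≈u x) (u≈v x)

Increasing : ∀ {m} → (Fin (suc m) → ℕ) → Set
Increasing g = ∀ j → g (inject₁ j) ℕ.< g (Fin.suc j)

increasing⇒toℕ≤ : ∀ {m} (g : Fin (suc m) → ℕ) → Increasing g → ∀ k → toℕ k ℕ.≤ g k
increasing⇒toℕ≤         g g↑ Fin.zero    = ℕ.z≤n
increasing⇒toℕ≤ {suc m} g g↑ (Fin.suc j) =
  ℕP.≤-trans (ℕ.s≤s (increasing⇒toℕ≤ (g ∘ inject₁) (g↑ ∘ inject₁) j)) (g↑ j)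

increasing⇒≤last : ∀ {m} (g : Fin (suc m) → ℕ) → Increasing g →
                   ∀ k → g k ℕ.+ (m ∸ toℕ k) ℕ.≤ g (Fin.fromℕ m)
increasing⇒≤last {zero}  g g↑ Fin.zero    = ℕP.≤-reflexive (ℕP.+-identityʳ (g Fin.zero))
increasing⇒≤last {suc m} g g↑ Fin.zero    = begin
  g Fin.zero ℕ.+ suc m        ≡⟨ ℕP.+-suc (g Fin.zero) m ⟩
  suc (g Fin.zero) ℕ.+ m      ≤⟨ ℕP.+-monoˡ-≤ m (g↑ Fin.zero) ⟩
  g (Fin.suc Fin.zero) ℕ.+ m  ≤⟨ increasing⇒≤last (g ∘ Fin.suc) (g↑ ∘ Fin.suc) Fin.zero ⟩
  g (Fin.fromℕ (suc m))       ∎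
  where open ℕP.≤-Reasoning
increasing⇒≤last {suc m} g g↑ (Fin.suc k) = increasing⇒≤last (g ∘ Fin.suc) (g↑ ∘ Fin.suc) k

increasing⇒≡id : ∀ {m} (f : Fin (suc m) → Fin (suc m)) → Increasing (toℕ ∘ f) → ∀ k → f k ≡ k
increasing⇒≡id {m} f f↑ k = toℕ-injective (ℕP.≤-antisym fk≤k (increasing⇒toℕ≤ (toℕ ∘ f) f↑ k))
  where
  fk≤k : toℕ (f k) ℕ.≤ toℕ k
  fk≤k = ℕP.+-cancelʳ-≤ (m ∸ toℕ k) (toℕ (f k)) (toℕ k) $ begin
    toℕ (f k) ℕ.+ (m ∸ toℕ k)  ≤⟨ increasing⇒≤last (toℕ ∘ f) f↑ k ⟩
    toℕ (f (Fin.fromℕ m))      ≤⟨ FinP.toℕ≤pred[n] (f (Fin.fromℕ m)) ⟩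
    m                          ≡⟨ ℕP.m+[n∸m]≡n (FinP.toℕ≤pred[n] k) ⟨
    toℕ k ℕ.+ (m ∸ toℕ k)      ∎
    where open ℕP.≤-Reasoning

no-descent⇒≈id : ∀ {m} (w : Perm (suc m)) → (∀ j → ¬ LeftDescent j w) → w ≈ idP
no-descent⇒≈id w no-descent x = trans (cong (w ⟨$⟩ʳ_) (sym (increasing⇒≡id (w ⟨$⟩ˡ_) ascent x))) (inverseʳ w)
  where
  ascent : ∀ j → LeftAscent j w
  ascent j with AdjacentTransposition.ascent-or-descent j w
  ... | inj₁ j-ascent  = j-ascent
  ... | inj₂ j-descent = contradiction j-descent (no-descent j)

reducedWord-of-length : ∀ {m} n (w : Perm (suc m)) → ℓ w ≡ n → ∃[ ws ] Reduced ws w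
reducedWord-of-length {m} n w ℓw≡n with any? (λ j → w ⟨$⟩ˡ Fin.suc j Fin.<? w ⟨$⟩ˡ inject₁ j)
... | no ∄descent = [] , trans (sym (ℓ-id {suc m})) (sym (ℓ-cong {u = w} {idP} w≈id)) , λ x → sym (w≈id x)
  where
  w≈id : w ≈ idP
  w≈id = no-descent⇒≈id w λ j j-descent → ∄descent (j , j-descent)
... | yes (j , j-descent) = descend n (trans (sym ℓw≡n) (ℓ-descent w j-descent))
  where
  open AdjacentTransposition j using (ℓ-descent; Reduced-∷-descent)
  descend : ∀ n → n ≡ suc (ℓ (s j · w)) → ∃[ ws ] Reduced ws w
  descend (suc n) n≡ℓ with reducedWord-of-length n (s j · w) (sym (ℕP.suc-injective n≡ℓ))
  ... | ws , ws-reduced = j ∷ ws , Reduced-∷-descent {ws} w j-descent ws-reduced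

reducedWord : ∀ {m} (w : Perm (suc m)) → ∃[ ws ] Reduced ws w
reducedWord w = reducedWord-of-length (ℓ w) w refl

-- The twisted Demazure algebra

≈?-complete : ∀ {n} {u v : Perm n} → u ≈ v → u ≈? v ≡ true
≈?-complete {u = u} {v} u≈v = dec-true (all? λ x → u ⟨$⟩ʳ x ≟ᶠ v ⟨$⟩ʳ x) u≈v

module TwistedMultiplication {m : ℕ} (i : Fin m) where
  open AdjacentTransposition i using (ℓ-ascent; ℓ-descent; ℓ-s-s; s-involutive; s·w≉w)

  εεcoef-up : ∀ u v → ℓ u ℕ.< ℓ (s i · u) → εεcoef i u v ≡ (if (s i · u) ≈? v then 1ℤ else 0ℤ)
  εεcoef-up u v ℓ-up rewrite dec-true (ℓ u ℕ.<? ℓ (s i · u)) ℓ-up = refl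

  εεcoef-down : ∀ u v → ¬ ℓ u ℕ.< ℓ (s i · u) → εεcoef i u v ≡ (if u ≈? v then -1ℤ else 0ℤ)
  εεcoef-down u v ℓ-not-up rewrite dec-false (ℓ u ℕ.<? ℓ (s i · u)) ℓ-not-up = refl

  εεcoef-ascent-diagonal : ∀ v → LeftAscent i v → εεcoef i v v ≡ 0ℤ
  εεcoef-ascent-diagonal v ascent =
    trans (εεcoef-up v v (ℕP.≤-reflexive (sym (ℓ-ascent v ascent)))) (cong (if_then 1ℤ else 0ℤ) (s·w≉w v))

  εεcoef-ascent-off-diagonal : ∀ v → LeftAscent i v → εεcoef i (s i · v) v ≡ 0ℤ
  εεcoef-ascent-off-diagonal v ascent = trans (εεcoef-down (s i · v) v ℓ-not-up) (cong (if_then -1ℤ else 0ℤ) (s·w≉w v))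
    where
    ℓ-not-up : ¬ ℓ (s i · v) ℕ.< ℓ (s i · (s i · v))
    ℓ-not-up rewrite ℓ-s-s v | ℓ-ascent v ascent = ℕP.<-asym (ℕP.n<1+n (ℓ v))

  εεcoef-descent-diagonal : ∀ v → LeftDescent i v → εεcoef i v v ≡ -1ℤ
  εεcoef-descent-diagonal v descent =
    trans (εεcoef-down v v ℓ-not-up) (cong (if_then -1ℤ else 0ℤ) (≈?-complete {u = v} {v} λ _ → refl))
    where
    ℓ-not-up : ¬ ℓ v ℕ.< ℓ (s i · v)
    ℓ-not-up rewrite ℓ-descent v descent = ℕP.<-asym (ℕP.n<1+n (ℓ (s i · v)))

  εεcoef-descent-off-diagonal : ∀ v → LeftDescent i v → εεcoef i (s i · v) v ≡ 1ℤ
  εεcoef-descent-off-diagonal v descent =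
    trans (εεcoef-up (s i · v) v ℓ-up)
          (cong (if_then 1ℤ else 0ℤ) (≈?-complete {u = s i · (s i · v)} {v} (s-involutive v)))
    where
    ℓ-up : ℓ (s i · v) ℕ.< ℓ (s i · (s i · v))
    ℓ-up = ℕP.≤-reflexive (trans (sym (ℓ-descent v descent)) (sym (ℓ-s-s v)))

  εmul-ascent : ∀ A v γ → LeftAscent i v → εmul i A v γ ≡ 0ℤ
  εmul-ascent A v γ ascent
    rewrite εεcoef-ascent-diagonal v ascent | εεcoef-ascent-off-diagonal v ascent = refl

  εmul-descent : ∀ A v γ → LeftDescent i v → εmul i A v γ ≡ A (s i · v) γ - A v γ
  εmul-descent A v γ descent
    rewrite εεcoef-descent-diagonal v descent | εεcoef-descent-off-diagonal v descent = reorder (A v γ) (A (s i · v) γ)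
    where
    reorder : ∀ a b → -1ℤ * a + 1ℤ * b ≡ b - a
    reorder = solve-∀

module DemazureCharacters {m : ℕ} (f : Series (suc m)) (κ : Perm (suc m) → Series (suc m))
  (κ-reduced : ∀ w ws → Reduced ws w → ∀ α → κ w α ≡ πWord ws f α) where

  κ-cong : ∀ {u v} → u ≈ v → ∀ α → κ u α ≡ κ v α
  κ-cong {u} {v} u≈v α with reducedWord u
  ... | ws , ws-reduced =
    trans (κ-reduced u ws ws-reduced α) (sym (κ-reduced v ws (Reduced-resp-≈ {ws = ws} {u} {v} u≈v ws-reduced) α))

  module _ (i : Fin m) where
    open Slice i using (πD-cong; πD-idempotent)
    open AdjacentTransposition i
      using (ascent-or-descent; ascent⇒descent-·w₀; descent⇒ascent-·w₀; Reduced-∷-ascent; Reduced-∷-descent)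
    open TwistedMultiplication i using (εmul-ascent; εmul-descent)

    πD-κ-descent : ∀ w → LeftDescent i w → ∀ α → πD i (κ w) α ≡ κ w α
    πD-κ-descent w descent α with reducedWord (s i · w)
    ... | ws , ws-reduced = begin
      πD i (κ w) α                ≡⟨ πD-cong (κ w) (πWord (i ∷ ws) f) (κ-reduced w (i ∷ ws) i∷ws-reduced) α ⟩
      πD i (πD i (πWord ws f)) α  ≡⟨ πD-idempotent (πWord ws f) α ⟩
      πD i (πWord ws f) α         ≡⟨ κ-reduced w (i ∷ ws) i∷ws-reduced α ⟨
      κ w α                       ∎
      where
      open ≡-Reasoning
      i∷ws-reduced : Reduced (i ∷ ws) w
      i∷ws-reduced = Reduced-∷-descent {ws} w descent ws-reduced

    πD-κ-ascent : ∀ w → LeftAscent i w → ∀ α → πD i (κ w) α ≡ κ (s i · w) α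
    πD-κ-ascent w ascent α with reducedWord w
    ... | ws , ws-reduced = begin
      πD i (κ w) α         ≡⟨ πD-cong (κ w) (πWord ws f) (κ-reduced w ws ws-reduced) α ⟩
      πD i (πWord ws f) α  ≡⟨ κ-reduced (s i · w) (i ∷ ws) (Reduced-∷-ascent {ws} w ascent ws-reduced) α ⟨
      κ (s i · w) α        ∎
      where open ≡-Reasoning

    πD-twisted : (A : Alg m) → (∀ u γ → A u γ ≡ κ (u · w₀) γ) →
                 ∀ v α → πD i (A v) α ≡ (εmul i A v +S A v) α
    πD-twisted A A≗κ v α with ascent-or-descent v
    ... | inj₁ ascent = begin
      πD i (A v) α          ≡⟨ πD-cong (A v) (κ (v · w₀)) (A≗κ v) α ⟩
      πD i (κ (v · w₀)) α   ≡⟨ πD-κ-descent (v · w₀) (ascent⇒descent-·w₀ v ascent) α ⟩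
      κ (v · w₀) α          ≡⟨ A≗κ v α ⟨
      A v α                 ≡⟨ ℤP.+-identityˡ (A v α) ⟨
      0ℤ + A v α            ≡⟨ cong (_+ A v α) (εmul-ascent A v α ascent) ⟨
      εmul i A v α + A v α  ∎
      where open ≡-Reasoning
    ... | inj₂ descent = begin
      πD i (A v) α                      ≡⟨ πD-cong (A v) (κ (v · w₀)) (A≗κ v) α ⟩
      πD i (κ (v · w₀)) α               ≡⟨ πD-κ-ascent (v · w₀) (descent⇒ascent-·w₀ v descent) α ⟩
      κ (s i · (v · w₀)) α              ≡⟨ κ-cong {s i · (v · w₀)} {(s i · v) · w₀} (λ _ → refl) α ⟩
      κ ((s i · v) · w₀) α              ≡⟨ A≗κ (s i · v) α ⟨
      A (s i · v) α                     ≡⟨ cancel (A (s i · v) α) (A v α) ⟨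
      (A (s i · v) α - A v α) + A v α   ≡⟨ cong (_+ A v α) (εmul-descent A v α descent) ⟨
      εmul i A v α + A v α              ∎
      where
      open ≡-Reasoning
      cancel : ∀ a b → (a - b) + b ≡ a
      cancel = solve-∀

𝒦-partition : ∀ {m} K (β : Exp (suc m)) → T (isPartition β) → ∀ v γ → 𝒦 K β v γ ≡ K β (v · w₀) γ
𝒦-partition K β partition v γ with isPartition β
... | true = refl

𝒦-non-partition : ∀ {m} K (β : Exp (suc m)) → ¬ T (isPartition β) → ∀ v γ → 𝒦 K β v γ ≡ 0ℤ
𝒦-non-partition K β ¬partition v γ with isPartition β
... | true  = contradiction _ ¬partition
... | false = refl

proposition3p4 : (m : ℕ)
    → (K : Exp (suc m) → Perm (suc m) → Series (suc m))
    → (∀ (λ' : Exp (suc m)) (w : Perm (suc m)) (ws : List (Fin m))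
         → T (isPartition λ') → Reduced ws w
         → ∀ α → K λ' w α ≡ πWord ws (monomial λ') α)
    → ∀ (i : Fin m) (β : Exp (suc m)) (v : Perm (suc m)) (α : Exp (suc m))
    → πD i (𝒦 K β v) α ≡ (εmul i (𝒦 K β) v +S 𝒦 K β v) α
proposition3p4 m K hK i β v α with T? (isPartition β)
... | yes partition =
  DemazureCharacters.πD-twisted (monomial β) (K β) (λ w ws → hK β w ws partition)
    i (𝒦 K β) (𝒦-partition K β partition) v α
-- Off partitions 𝒦 vanishes, and so do the Demazure characters of the zero series.
... | no ¬partition =
  DemazureCharacters.πD-twisted zeroS (λ _ → zeroS) (λ _ ws _ α → sym (πWord-zero ws α))
    i (𝒦 K β) (𝒦-non-partition K β ¬partition) v α
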